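{- Let $m\ge2$, $n\ge1$ and for $w\in G(m,1,n)$ let $inv(w)=\sum_{i=1}^n inv_i(w)$. Then \[ \sum_{w\in G(m,1,n)} q^{inv(w)}=\prod_{i=1}^n[im]_q, \] where $q$ is an indeterminate and $[im]_q=\frac{1-q^{im}}{1-q}$.
   Context: Let $\varepsilon=e^{2\pi i/m}$ and $e_1,\dots,e_n$ the standard basis of $\mathbb C^n$. $G(m,1,n)$ consists of the bijections $w$ of $\{\varepsilon^k i:1\le i\le n,1\le k\le m\}$ with $w(\varepsilon^k i)=\varepsilon^k w(i)$; writing $w(j)=\varepsilon^{r_j}\beta_j$ ($\beta\in S_n$, $0\le r_j\le m-1$), $w$ acts linearly on $\mathbb C^n$ by $w(e_j)=\varepsilon^{r_j}e_{\beta_j}$. Let $\Phi=\{\varepsilon^i e_j-\varepsilon^k e_l : \varepsilon^i e_j\ne\varepsilon^k e_l,\ 0\le i,k\le m-1,\ 1\le j,l\le n\}$, $\Phi^+=\{\varepsilon^i e_j-\varepsilon^k e_j\in\Phi : 0\le i<k\le m-1\}\cup\{e_j-\varepsilon^k e_l\in\Phi: 0\le k\le m-1,\ 1\le l<j\le n\}\cup\{\varepsilon^i e_j-\varepsilon^k e_l\in\Phi: 0\le i,k\le m-1,\ k\ne 0,\ 1\le j<l\le n\}$, $\Phi^-=\Phi\setminus\Phi^+$, and for $i=1,\dots,n$, $\Delta_i=\{e_{n+1-i}-\varepsilon^k e_{n+1-i}: 0<k\le m-1\}\cup\{e_{n+1-i}-\varepsilon^k e_j: 0\le k\le m-1,\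 j<n+1-i\}$. Define $inv_i(w)=|w(\Delta_i)\cap\Phi^-|$. -}

module Defs where

open import Data.Nat using (ℕ; zero; suc; _+_; _*_; NonZero)
open import Data.Nat.DivMod using (_mod_)
open import Data.Fin using (Fin; toℕ; opposite; _<_)
open import Data.Fin.Properties using (_<?_) renaming (_≟_ to _≟ᶠ_)
open import Data.Product using (_×_; _,_; proj₁; proj₂)
open import Data.Product.Properties using (≡-dec)
open import Data.Sum using (_⊎_)
open import Data.List using (List; []; _∷_; map; concatMap; filter; length; allFin; cartesianProduct; foldr; upTo)
open import Data.List.Relation.Unary.AllPairs using (AllPairs; allPairs?)
open import Data.Vec using (Vec; []; _∷_; toList; lookup)
import Data.Vec as Vec
open import Relation.Nullary using (¬_; Dec; ¬?; yes; no)
open import Relation.Nullary.Decidable using (_⊎-dec_; _×-dec_)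
open import Relation.Binary.PropositionalEquality using (_≡_; _≢_)
open import Algebra.Bundles using (CommutativeSemiring)
import Algebra.Definitions.RawSemiring as RS

-- Conventions (0-based indexing: Fin m for exponents k of ε = e^{2πi/m},
-- Fin n for basis indices 1..n shifted down by one).

-- The "point" ε^k e_j (equivalently the element ε^k j on which G acts).
Point : ℕ → ℕ → Set
Point m n = Fin m × Fin n

-- A formal root ε^i e_j - ε^k e_l, recorded as the ordered pair of points.
Root : ℕ → ℕ → Set
Root m n = Point m n × Point m n

IsRoot : ∀ {m n} → Root m n → Set
IsRoot (a , b) = a ≢ b

IsPositive : ∀ {m n} → Root m n → Set
IsPositive ((i , j) , (k , l)) =
  (j ≡ l × toℕ i Data.Nat.< toℕ k)
  ⊎ ((l < j × toℕ i ≡ 0)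
  ⊎ (j < l × toℕ k ≢ 0))

IsNegative : ∀ {m n} → Root m n → Set
IsNegative r = IsRoot r × ¬ IsPositive r

-- Elements of G(m,1,n): w is recorded by (w(1),…,w(n)), w(j) = ε^{r_j} β_j,
-- with β a permutation, i.e. the β_j pairwise distinct.
IsGElem : ∀ {m n} → Vec (Point m n) n → Set
IsGElem w = AllPairs _≢_ (toList (Vec.map proj₂ w))

actPoint : ∀ {m n} .{{_ : NonZero m}} → Vec (Point m n) n → Point m n → Point m n
actPoint {m} w (k , j) with lookup w j
... | (r , b) = ((toℕ k + toℕ r) mod m , b)

actRoot : ∀ {m n} .{{_ : NonZero m}} → Vec (Point m n) n → Root m n → Root m n
actRoot w (a , b) = (actPoint w a , actPoint w b)

-- Δ_i for i ∈ {1..n}; the argument i : Fin n is i-1, and p = opposite i is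
-- the 0-based version of n+1-i.  e_p is ε^0 e_p.
Δ : ∀ {m n} .{{_ : NonZero m}} → Fin n → List (Root m n)
Δ {m} {n} i =
  map (λ k → ((e0 , p) , (k , p))) (filter (λ k → ¬? (toℕ k Data.Nat.≟ 0)) (allFin m))
  Data.List.++
  concatMap (λ k → map (λ j → ((e0 , p) , (k , j))) (filter (λ j → j <? p) (allFin n))) (allFin m)
  where
  p = opposite i
  e0 : Fin m
  e0 = 0 mod m

isNegative? : ∀ {m n} (r : Root m n) → Dec (IsNegative r)
isNegative? ((i , j) , (k , l)) =
  ¬? (≡-dec _≟ᶠ_ _≟ᶠ_ (i , j) (k , l))
  ×-dec ¬? (((j ≟ᶠ l) ×-dec (toℕ i Data.Nat.<? toℕ k))
           ⊎-dec (((l <? j) ×-dec (toℕ i Data.Nat.≟ 0))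
           ⊎-dec ((j <? l) ×-dec ¬? (toℕ k Data.Nat.≟ 0))))

-- inv_i(w) = |w(Δ_i) ∩ Φ⁻|  (w is injective on roots, so this counts the
-- d ∈ Δ_i with w(d) ∈ Φ⁻).
invᵢ : ∀ {m n} .{{_ : NonZero m}} → Vec (Point m n) n → Fin n → ℕ
invᵢ w i = length (filter (λ d → isNegative? (actRoot w d)) (Δ i))

inv : ∀ {m n} .{{_ : NonZero m}} → Vec (Point m n) n → ℕ
inv {n = n} w = foldr _+_ 0 (map (invᵢ w) (allFin n))

allVecs : ∀ {A : Set} → List A → (k : ℕ) → List (Vec A k)
allVecs xs zero = [] ∷ []
allVecs xs (suc k) = concatMap (λ x → map (x ∷_) (allVecs xs k)) xs

GElems : (m n : ℕ) → List (Vec (Point m n) n)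
GElems m n = filter (λ w → allPairs? (λ a b → ¬? (a ≟ᶠ b)) (toList (Vec.map proj₂ w)))
                    (allVecs (cartesianProduct (allFin m) (allFin n)) n)

module _ {c ℓ} (R : CommutativeSemiring c ℓ) where
  open CommutativeSemiring R using (Carrier; 0#; 1#) renaming (_+_ to _+R_; _*_ to _*R_)
  open CommutativeSemiring R using (rawSemiring)
  open RS rawSemiring using (_^_)

  invGenFun : (m n : ℕ) .{{_ : NonZero m}} → Carrier → Carrier
  invGenFun m n q = foldr _+R_ 0# (map (λ w → q ^ inv w) (GElems m n))

  -- [N]_q = (1 - q^N)/(1 - q) = 1 + q + ⋯ + q^{N-1}
  qInt : ℕ → Carrier → Carrier
  qInt N q = foldr _+R_ 0# (map (q ^_) (upTo N))

  qProd : (m n : ℕ) → Carrier → Carrier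
  qProd m n q = foldr _*R_ 1# (map (λ i → qInt (suc i * m) q) (upTo n))

module Submission where

-- Write w ∈ G(m,1,n) through its images w(e_j) = ε^(r_j) e_(β_j). The set Δ_i only involves the coordinate
-- p = n+1-i and the coordinates j < p, and the negative images can be counted explicitly: the roots
-- e_p − ε^k e_p give r_p of them, and each j < p gives one if β_j > β_p, and m (or none, if r_p = 0) if
-- β_j < β_p. Removing the last coordinate, with image ε^r e_v, and relabelling the remaining columns
-- monotonically onto {1,…,n−1} gives an element of G(m,1,n−1) with the same number of inversions, while the
-- last coordinate contributes r + (n − v) + (v − 1)·[r ≠ 0]·m. As (r , v) runs over all m n choices these
-- exponents run exactly once through 0,…,nm − 1, so each step contributes the factor [nm]_q.

open import Defs
open import Data.Nat using (ℕ; zero; suc; _≤_; NonZero)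
open import Algebra.Bundles using (CommutativeSemiring)
open import Data.Fin using (Fin; zero; suc; toℕ; _<_; punchIn; inject₁; fromℕ; opposite)
open import Data.Fin.Properties using (punchInᵢ≢i; punchIn-mono-≤; punchIn-injective; toℕ-injective; toℕ<n)
open import Data.List.Relation.Unary.All using (All; []; _∷_)
import Data.List.Relation.Unary.All.Properties as All
open import Data.List.Relation.Unary.AllPairs using (AllPairs; []; _∷_)
open import Data.Fin.Permutation using (reverse)
open import Data.List using (List; []; _∷_; _++_; map; foldr; filter; concatMap; cartesianProduct; tabulate; allFin; applyUpTo)
import Data.Vec.Functional as Vector
open import Data.Vec using (Vec; []; _∷_; _∷ʳ_; lookup)
import Data.Nat as ℕ
import Data.Nat.Properties as ℕ
import Algebra.Properties.CommutativeSemigroup ℕ.+-commutativeSemigroup as ℕ+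
open import Data.Product using (_×_; _,_; proj₁; proj₂)
open import Relation.Nullary using (Dec; yes; no; ¬_; ¬?)
open import Relation.Nullary.Negation using (contradiction)
open import Relation.Unary using (Decidable)
open import Function.Bundles using (_⇔_; mk⇔; Equivalence)
open import Relation.Binary.PropositionalEquality as ≡ using (_≡_; _≢_)

module Sums {c ℓ} (S : CommutativeSemiring c ℓ) where
  open CommutativeSemiring S hiding (zero)
  open import Relation.Binary.Reasoning.Setoid setoid
  open import Algebra.Properties.Semiring.Sum semiring public
  open import Algebra.Properties.CommutativeSemigroup +-commutativeSemigroup using (x∙yz≈y∙xz)
  open import Data.Fin.Properties using (_≟_)
  open import Data.Nat.DivMod using (_%_; m<n⇒m%n≡m; [m+n]%n≡m%n)

  when : ∀ {p} {P : Set p} → Dec P → Carrier → Carrier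
  when (yes _) x = x
  when (no _) _ = 0#

  when-⇔ : ∀ {p q} {P : Set p} {Q : Set q} (d : Dec P) (e : Dec Q) → P ⇔ Q → ∀ x → when d x ≈ when e x
  when-⇔ (yes _) (yes _) _ x = refl
  when-⇔ (yes p) (no ¬q) P⇔Q x = contradiction (Equivalence.to P⇔Q p) ¬q
  when-⇔ (no ¬p) (yes q) P⇔Q x = contradiction (Equivalence.from P⇔Q q) ¬p
  when-⇔ (no _) (no _) _ x = refl

  module _ {p} {P : Set p} where

    when-yes : (d : Dec P) → P → ∀ x → when d x ≈ x
    when-yes (yes _) _ x = refl
    when-yes (no ¬p) p x = contradiction p ¬p

    when-no : (d : Dec P) → ¬ P → ∀ x → when d x ≈ 0#
    when-no (yes p) ¬p x = contradiction p ¬p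
    when-no (no _) _ x = refl

    when-congʳ : (d : Dec P) {x y : Carrier} → (P → x ≈ y) → when d x ≈ when d y
    when-congʳ (yes p) x≈y = x≈y p
    when-congʳ (no _) _ = refl

    when-*ˡ : (d : Dec P) (x y : Carrier) → when d (x * y) ≈ x * when d y
    when-*ˡ (yes _) x y = refl
    when-*ˡ (no _) x y = sym (zeroʳ x)

    when-when : ∀ {q r} {Q : Set q} {R : Set r} (d : Dec P) (e : Dec Q) (f : Dec R) →
                (P → Q → R) → (R → P × Q) → ∀ x → when d (when e x) ≈ when f x
    when-when (yes p) e f h k x = when-⇔ e f (mk⇔ (h p) (λ r → proj₂ (k r))) x
    when-when (no ¬p) e (yes r) h k x = contradiction (proj₁ (k r)) ¬p
    when-when (no _) e (no _) h k x = refl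

  sumOver : ∀ {a} {A : Set a} → List A → (A → Carrier) → Carrier
  sumOver xs f = foldr _+_ 0# (map f xs)

  module _ {a} {A : Set a} where

    sumOver-cong : (xs : List A) {f g : A → Carrier} → (∀ x → f x ≈ g x) → sumOver xs f ≈ sumOver xs g
    sumOver-cong [] _ = refl
    sumOver-cong (x ∷ xs) f≈g = +-cong (f≈g x) (sumOver-cong xs f≈g)

    sumOver-zero : (xs : List A) → sumOver xs (λ _ → 0#) ≈ 0#
    sumOver-zero [] = refl
    sumOver-zero (x ∷ xs) = trans (+-identityˡ _) (sumOver-zero xs)

    sumOver-++ : (xs ys : List A) (f : A → Carrier) → sumOver (xs ++ ys) f ≈ sumOver xs f + sumOver ys f
    sumOver-++ [] ys f = sym (+-identityˡ _)
    sumOver-++ (x ∷ xs) ys f = trans (+-congˡ (sumOver-++ xs ys f)) (sym (+-assoc _ _ _))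

    sumOver-distrib-+ : (xs : List A) (f g : A → Carrier) → sumOver xs (λ x → f x + g x) ≈ sumOver xs f + sumOver xs g
    sumOver-distrib-+ [] f g = sym (+-identityˡ _)
    sumOver-distrib-+ (x ∷ xs) f g = begin
      (f x + g x) + sumOver xs (λ x → f x + g x) ≈⟨ +-congˡ (sumOver-distrib-+ xs f g) ⟩
      (f x + g x) + (sumOver xs f + sumOver xs g) ≈⟨ +-assoc _ _ _ ⟩
      f x + (g x + (sumOver xs f + sumOver xs g)) ≈⟨ +-congˡ (x∙yz≈y∙xz _ _ _) ⟩
      f x + (sumOver xs f + (g x + sumOver xs g)) ≈⟨ sym (+-assoc _ _ _) ⟩
      (f x + sumOver xs f) + (g x + sumOver xs g) ∎

    *-distribˡ-sumOver : (k : Carrier) (xs : List A) (f : A → Carrier) → k * sumOver xs f ≈ sumOver xs (λ x → k * f x)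
    *-distribˡ-sumOver k [] f = zeroʳ k
    *-distribˡ-sumOver k (x ∷ xs) f = trans (distribˡ k _ _) (+-congˡ (*-distribˡ-sumOver k xs f))

    sumOver-filter : ∀ {p} {P : A → Set p} (P? : Decidable P) (xs : List A) (f : A → Carrier) →
                     sumOver (filter P? xs) f ≈ sumOver xs (λ x → when (P? x) (f x))
    sumOver-filter P? [] f = refl
    sumOver-filter P? (x ∷ xs) f with P? x
    ... | yes _ = +-congˡ (sumOver-filter P? xs f)
    ... | no _ = trans (sumOver-filter P? xs f) (sym (+-identityˡ _))

    when-sumOver : ∀ {p} {P : Set p} (d : Dec P) (xs : List A) (f : A → Carrier) →
                   when d (sumOver xs f) ≈ sumOver xs (λ x → when d (f x))
    when-sumOver (yes _) xs f = refl
    when-sumOver (no _) xs f = sym (sumOver-zero xs)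

  sumOver-map : ∀ {a b} {A : Set a} {B : Set b} (g : A → B) (xs : List A) (f : B → Carrier) → sumOver (map g xs) f ≡ sumOver xs (λ x → f (g x))
  sumOver-map g [] f = ≡.refl
  sumOver-map g (x ∷ xs) f = ≡.cong (f (g x) +_) (sumOver-map g xs f)

  module _ {a b} {A : Set a} {B : Set b} where

    sumOver-concatMap : (g : A → List B) (xs : List A) (f : B → Carrier) →
                        sumOver (concatMap g xs) f ≈ sumOver xs (λ x → sumOver (g x) f)
    sumOver-concatMap g [] f = refl
    sumOver-concatMap g (x ∷ xs) f = trans (sumOver-++ (g x) _ f) (+-congˡ (sumOver-concatMap g xs f))

    sumOver-cartesianProduct : (xs : List A) (ys : List B) (f : A × B → Carrier) →
                               sumOver (cartesianProduct xs ys) f ≈ sumOver xs (λ x → sumOver ys (λ y → f (x , y)))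
    sumOver-cartesianProduct [] ys f = refl
    sumOver-cartesianProduct (x ∷ xs) ys f =
      trans (sumOver-++ (map (x ,_) ys) _ f) (+-cong (reflexive (sumOver-map (x ,_) ys f)) (sumOver-cartesianProduct xs ys f))

    sumOver-comm : (xs : List A) (ys : List B) (f : A → B → Carrier) →
                   sumOver xs (λ x → sumOver ys (f x)) ≈ sumOver ys (λ y → sumOver xs (λ x → f x y))
    sumOver-comm [] ys f = sym (sumOver-zero ys)
    sumOver-comm (x ∷ xs) ys f = trans (+-congˡ (sumOver-comm xs ys f)) (sym (sumOver-distrib-+ ys (f x) _))

  sumOver-tabulate : ∀ {a} {A : Set a} n (g : Fin n → A) (f : A → Carrier) → sumOver (tabulate g) f ≡ ∑[ i < n ] f (g i)
  sumOver-tabulate zero g f = ≡.refl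
  sumOver-tabulate (suc n) g f = ≡.cong (f (g zero) +_) (sumOver-tabulate n (λ i → g (suc i)) f)

  sumOver-allFin : ∀ n (f : Fin n → Carrier) → sumOver (allFin n) f ≡ ∑[ i < n ] f i
  sumOver-allFin n = sumOver-tabulate n (λ i → i)

  sumOver-allVecs-∷ : ∀ {A : Set} (xs : List A) k (f : Vec A (suc k) → Carrier) →
                      sumOver (allVecs xs (suc k)) f ≈ sumOver xs (λ y → sumOver (allVecs xs k) (λ u → f (y ∷ u)))
  sumOver-allVecs-∷ xs k f = trans (sumOver-concatMap (λ y → map (y ∷_) (allVecs xs k)) xs f)
                                   (sumOver-cong xs (λ y → reflexive (sumOver-map (y ∷_) (allVecs xs k) f)))

  sumOver-allVecs-∷ʳ : ∀ {A : Set} (xs : List A) k (f : Vec A (suc k) → Carrier) →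
                       sumOver (allVecs xs (suc k)) f ≈ sumOver (allVecs xs k) (λ u → sumOver xs (λ x → f (u ∷ʳ x)))
  sumOver-allVecs-∷ʳ xs zero f = trans (sumOver-allVecs-∷ xs 0 f) (trans (sumOver-cong xs (λ x → +-identityʳ _)) (sym (+-identityʳ _)))
  sumOver-allVecs-∷ʳ xs (suc k) f = begin
    sumOver (allVecs xs (suc (suc k))) f                                     ≈⟨ sumOver-allVecs-∷ xs (suc k) f ⟩
    sumOver xs (λ y → sumOver (allVecs xs (suc k)) (λ u → f (y ∷ u)))         ≈⟨ sumOver-cong xs (λ y → sumOver-allVecs-∷ʳ xs k (λ u → f (y ∷ u))) ⟩
    sumOver xs (λ y → sumOver (allVecs xs k) (λ u → sumOver xs (λ x → f (y ∷ (u ∷ʳ x)))))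
                                                                             ≈⟨ sym (sumOver-allVecs-∷ xs k (λ u → sumOver xs (λ x → f (u ∷ʳ x)))) ⟩
    sumOver (allVecs xs (suc k)) (λ u → sumOver xs (λ x → f (u ∷ʳ x)))        ∎

  sum-split : ∀ a b (g : ℕ → Carrier) →
              ∑[ k < a ℕ.+ b ] g (toℕ k) ≈ ∑[ k < a ] g (toℕ k) + ∑[ k < b ] g (a ℕ.+ toℕ k)
  sum-split zero b g = sym (+-identityˡ _)
  sum-split (suc a) b g = trans (+-congˡ (sum-split a b (λ k → g (suc k)))) (sym (+-assoc _ _ _))

  sum-opposite : ∀ n (f : Fin n → Carrier) → ∑[ i < n ] f (opposite i) ≈ ∑[ i < n ] f i
  sum-opposite n f = sym (∑-permute f reverse)

  sum-punchIn : ∀ n (v : Fin (suc n)) (g : Fin (suc n) → Carrier) →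
                ∑[ b < suc n ] when (¬? (b ≟ v)) (g b) ≈ ∑[ b < n ] g (punchIn v b)
  sum-punchIn n v g = begin
    ∑[ b < suc n ] when (¬? (b ≟ v)) (g b)                      ≈⟨ sum-remove {i = v} (λ b → when (¬? (b ≟ v)) (g b)) ⟩
    when (¬? (v ≟ v)) (g v) + ∑[ b < n ] when (¬? (punchIn v b ≟ v)) (g (punchIn v b))
      ≈⟨ +-cong (when-no (¬? (v ≟ v)) (λ v≢v → v≢v ≡.refl) _)
                (sum-cong-≋ (λ b → when-yes (¬? (punchIn v b ≟ v)) (punchInᵢ≢i v b) _)) ⟩
    0# + ∑[ b < n ] g (punchIn v b)                             ≈⟨ +-identityˡ _ ⟩
    ∑[ b < n ] g (punchIn v b)                                  ∎

  sum-rotate : ∀ m .{{_ : NonZero m}} s → s ℕ.< m → (g : ℕ → Carrier) →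
               ∑[ k < m ] g ((toℕ k ℕ.+ s) % m) ≈ ∑[ k < m ] g (toℕ k)
  sum-rotate m s s<m g with m ℕ.∸ s | ℕ.m∸n+n≡m (ℕ.<⇒≤ s<m)
  ... | d | ≡.refl = begin
    ∑[ k < d ℕ.+ s ] g ((toℕ k ℕ.+ s) % m)                          ≈⟨ sum-split d s (λ t → g ((t ℕ.+ s) % m)) ⟩
    ∑[ k < d ] g ((toℕ k ℕ.+ s) % m) + ∑[ k < s ] g ((d ℕ.+ toℕ k ℕ.+ s) % m)
      ≈⟨ +-cong (sum-cong-≋ (λ k → reflexive (≡.cong g (noWrap k)))) (sum-cong-≋ (λ k → reflexive (≡.cong g (wrap k)))) ⟩
    ∑[ k < d ] g (toℕ k ℕ.+ s) + ∑[ k < s ] g (toℕ k)               ≈⟨ +-comm _ _ ⟩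
    ∑[ k < s ] g (toℕ k) + ∑[ k < d ] g (toℕ k ℕ.+ s)
      ≈⟨ +-congˡ (sum-cong-≋ {d} (λ k → reflexive (≡.cong g (ℕ.+-comm (toℕ k) s)))) ⟩
    ∑[ k < s ] g (toℕ k) + ∑[ k < d ] g (s ℕ.+ toℕ k)               ≈⟨ sym (sum-split s d g) ⟩
    ∑[ k < s ℕ.+ d ] g (toℕ k)                                       ≡⟨ ≡.cong (λ t → ∑[ k < t ] g (toℕ k)) (ℕ.+-comm s d) ⟩
    ∑[ k < d ℕ.+ s ] g (toℕ k)                                       ∎
    where
    noWrap : (k : Fin d) → (toℕ k ℕ.+ s) % m ≡ toℕ k ℕ.+ s
    noWrap k = m<n⇒m%n≡m (ℕ.+-monoˡ-< s (toℕ<n k))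
    wrap : (k : Fin s) → (d ℕ.+ toℕ k ℕ.+ s) % m ≡ toℕ k
    wrap k = ≡.trans (≡.cong (_% m) (ℕ+.xy∙z≈y∙xz d (toℕ k) s))
             (≡.trans ([m+n]%n≡m%n (toℕ k) m) (m<n⇒m%n≡m (ℕ.<-≤-trans (toℕ<n k) (ℕ.m≤n+m s d))))

module Counting where
  open import Data.Nat using (_+_; _∸_; _≤?_; _<?_; _≟_; z≤n; s≤s; s≤s⁻¹; s<s; s<s⁻¹)
  open import Data.Nat.Properties
  open import Data.List using (length)
  open import Data.List.Properties using (length-++-sucʳ)
  open import Data.List.Membership.Propositional using (_∈_)
  open import Data.List.Membership.Propositional.Properties using (∈-∃++; ∈-++⁻; ∈-++⁺ˡ; ∈-++⁺ʳ; ∈-filter⁺; ∈-filter⁻; ∈-allFin)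
  open import Data.List.Relation.Unary.Any using (here; there)
  import Data.List.Relation.Unary.All as All
  open import Data.List.Relation.Unary.AllPairs using (AllPairs; _∷_)
  import Data.List.Relation.Unary.AllPairs.Properties as AllPairs
  open import Data.Sum using (inj₁; inj₂)
  open Sums +-*-commutativeSemiring public

  sum-ones : ∀ n → ∑[ k < n ] 1 ≡ n
  sum-ones zero = ≡.refl
  sum-ones (suc n) = ≡.cong suc (sum-ones n)

  count-≥ : ∀ n t → ∑[ k < n ] when (t ≤? toℕ k) 1 ≡ n ∸ t
  count-≥ zero t = ≡.sym (0∸n≡0 t)
  count-≥ (suc n) zero = ≡.cong suc (sum-ones n)
  count-≥ (suc n) (suc t) = ≡.trans (sum-cong-≋ {n} (λ k → when-⇔ (suc t ≤? suc (toℕ k)) (t ≤? toℕ k) (mk⇔ s≤s⁻¹ s≤s) 1)) (count-≥ n t)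

  count-< : ∀ {n t} → t ≤ n → ∑[ k < n ] when (toℕ k <? t) 1 ≡ t
  count-< {n} z≤n = sum-replicate-zero n
  count-< {suc n} {suc t} (s≤s t≤n) =
    ≡.cong suc (≡.trans (sum-cong-≋ {n} (λ k → when-⇔ (suc (toℕ k) <? suc t) (toℕ k <? t) (mk⇔ s<s⁻¹ s<s) 1)) (count-< t≤n))

  count-≡0 : ∀ n .{{_ : NonZero n}} → ∑[ k < n ] when (toℕ k ≟ 0) 1 ≡ 1
  count-≡0 (suc n) = ≡.cong suc (sum-replicate-zero n)

  length≡sumOver-ones : ∀ {a} {A : Set a} (xs : List A) → length xs ≡ sumOver xs (λ _ → 1)
  length≡sumOver-ones [] = ≡.refl
  length≡sumOver-ones (x ∷ xs) = ≡.cong suc (length≡sumOver-ones xs)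

  length-filter≡count : ∀ {a p} {A : Set a} {P : A → Set p} (P? : Decidable P) (xs : List A) →
                        length (filter P? xs) ≡ sumOver xs (λ x → when (P? x) 1)
  length-filter≡count P? xs = ≡.trans (length≡sumOver-ones (filter P? xs)) (sumOver-filter P? xs (λ _ → 1))

  count-const : ∀ {p} {P : Set p} (d : Dec P) n → ∑[ k < n ] when d 1 ≡ when d n
  count-const (yes _) n = sum-ones n
  count-const (no _) n = sum-replicate-zero n

  unique-⊆⇒length≤ : ∀ {a} {A : Set a} {xs ys : List A} → AllPairs _≢_ xs → (∀ {z} → z ∈ xs → z ∈ ys) → length xs ≤ length ys
  unique-⊆⇒length≤ {xs = []} _ _ = z≤n
  unique-⊆⇒length≤ {xs = x ∷ xs} (x∉xs ∷ unique) xs⊆ys with ∈-∃++ (xs⊆ys (here ≡.refl))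
  ... | ys₁ , ys₂ , ≡.refl = ≤-trans (s≤s (unique-⊆⇒length≤ unique xs⊆ys₁ys₂)) (≤-reflexive (≡.sym (length-++-sucʳ ys₁ x ys₂)))
    where
    xs⊆ys₁ys₂ : ∀ {z} → z ∈ xs → z ∈ ys₁ ++ ys₂
    xs⊆ys₁ys₂ z∈xs with ∈-++⁻ ys₁ (xs⊆ys (there z∈xs))
    ... | inj₁ z∈ys₁ = ∈-++⁺ˡ z∈ys₁
    ... | inj₂ (here ≡.refl) = contradiction ≡.refl (All.lookup x∉xs z∈xs)
    ... | inj₂ (there z∈ys₂) = ∈-++⁺ʳ ys₁ z∈ys₂

  count-unique≤ : ∀ {n p} {P : Fin n → Set p} (P? : Decidable P) {bs : List (Fin n)} → AllPairs _≢_ bs →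
                  sumOver bs (λ b → when (P? b) 1) ≤ ∑[ i < n ] when (P? i) 1
  count-unique≤ {n} P? {bs} unique = ≤-begin
    sumOver bs (λ b → when (P? b) 1)                 ≡⟨ ≡.sym (length-filter≡count P? bs) ⟩
    length (filter P? bs)                            ≤⟨ unique-⊆⇒length≤ (AllPairs.filter⁺ P? unique) filter⊆ ⟩
    length (filter P? (allFin n))                    ≡⟨ ≡.trans (length-filter≡count P? (allFin n)) (sumOver-allFin n (λ i → when (P? i) 1)) ⟩
    ∑[ i < n ] when (P? i) 1                         ∎
    where
    open ≤-Reasoning renaming (begin_ to ≤-begin_)
    filter⊆ : ∀ {z} → z ∈ filter P? bs → z ∈ filter P? (allFin n)
    filter⊆ z∈ = ∈-filter⁺ P? (∈-allFin _) (proj₂ (∈-filter⁻ P? {xs = bs} z∈))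

  -- The counts of P and of ¬P in bs are bounded by those in Fin n, and both pairs add up to n.
  count-unique-full : ∀ {n p} {P : Fin n → Set p} (P? : Decidable P) {bs : List (Fin n)} → AllPairs _≢_ bs → length bs ≡ n →
                      sumOver bs (λ b → when (P? b) 1) ≡ ∑[ i < n ] when (P? i) 1
  count-unique-full {n} P? {bs} unique length≡n =
    ≤-antisym (count-unique≤ P? unique) (≮⇒≥ λ fewer → <-irrefl total-bs (+-mono-<-≤ fewer (count-unique≤ (λ b → ¬? (P? b)) unique)))
    where
    split : ∀ b → when (P? b) 1 + when (¬? (P? b)) 1 ≡ 1
    split b with P? b
    ... | yes _ = ≡.refl
    ... | no _ = ≡.refl
    total-bs : sumOver bs (λ b → when (P? b) 1) + sumOver bs (λ b → when (¬? (P? b)) 1)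
             ≡ ∑[ i < n ] when (P? i) 1 + ∑[ i < n ] when (¬? (P? i)) 1
    total-bs = ≡.trans (≡.sym (sumOver-distrib-+ bs _ _))
               (≡.trans (sumOver-cong bs split)
               (≡.trans (≡.sym (length≡sumOver-ones bs))
               (≡.trans length≡n
               (≡.trans (≡.sym (sum-ones n)) (≡.trans (sum-cong-≋ {n} (λ i → ≡.sym (split i))) (∑-distrib-+ (λ i → when (P? i) 1) _))))))

weight : ∀ {m} → Fin m → ℕ
weight {m} r = Counting.when (¬? (toℕ r ℕ.≟ 0)) m

foldr-map-applyUpTo : ∀ {a} {B : Set a} (_∙_ : B → B → B) (e : B) (g : ℕ → B) (f : ℕ → ℕ) (n : ℕ) →
  foldr _∙_ e (map g (applyUpTo f n)) ≡ Vector.foldr _∙_ e (λ (i : Fin n) → g (f (toℕ i)))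
foldr-map-applyUpTo _∙_ e g f zero = ≡.refl
foldr-map-applyUpTo _∙_ e g f (suc n) = ≡.cong (g (f 0) ∙_) (foldr-map-applyUpTo _∙_ e g (λ k → f (suc k)) n)

module GeometricSums {c ℓ} (R : CommutativeSemiring c ℓ) (q : CommutativeSemiring.Carrier R) where
  open import Data.Nat using (_+_; _*_; _∸_)
  open import Data.Nat.Solver using (module +-*-Solver)
  open import Data.Fin.Properties using (opposite-prop)
  open CommutativeSemiring R hiding (zero) renaming (_+_ to _⊕_; _*_ to _⊗_)
  open import Algebra.Definitions.RawSemiring rawSemiring using (_^_)
  open import Algebra.Properties.Semiring.Exp semiring using (^-homo-*)
  open import Relation.Binary.Reasoning.Setoid setoid
  open Sums R

  geo : ℕ → Carrier
  geo N = ∑[ i < N ] (q ^ toℕ i)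

  qInt≡geo : ∀ N → qInt R N q ≡ geo N
  qInt≡geo = foldr-map-applyUpTo _⊕_ 0# (q ^_) (λ i → i)

  geo-+ : ∀ a b → geo (a + b) ≈ geo a ⊕ q ^ a ⊗ geo b
  geo-+ a b = trans (sum-split a b (q ^_))
    (+-congˡ (trans (sum-cong-≋ {b} (λ k → ^-homo-* q a (toℕ k))) (sym (*-distribˡ-sum {b} (q ^ a) (λ k → q ^ toℕ k)))))

  geo-* : ∀ a b → geo (a * b) ≈ ∑[ v < a ] ∑[ r < b ] (q ^ (toℕ v * b + toℕ r))
  geo-* zero b = refl
  geo-* (suc a) b = begin
    geo (b + a * b)                                                      ≈⟨ geo-+ b (a * b) ⟩
    geo b ⊕ q ^ b ⊗ geo (a * b)                                          ≈⟨ +-congˡ (*-congˡ (geo-* a b)) ⟩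
    geo b ⊕ q ^ b ⊗ ∑[ v < a ] ∑[ r < b ] (q ^ (toℕ v * b + toℕ r))        ≈⟨ +-congˡ (*-distribˡ-sum {a} (q ^ b) (λ v → ∑[ r < b ] (q ^ (toℕ v * b + toℕ r)))) ⟩
    geo b ⊕ ∑[ v < a ] (q ^ b ⊗ ∑[ r < b ] (q ^ (toℕ v * b + toℕ r)))
      ≈⟨ +-congˡ (sum-cong-≋ {a} λ v → trans (*-distribˡ-sum {b} (q ^ b) (λ r → q ^ (toℕ v * b + toℕ r))) (sum-cong-≋ {b} λ r →
           trans (sym (^-homo-* q b _)) (reflexive (≡.cong (q ^_) (≡.sym (ℕ.+-assoc b (toℕ v * b) (toℕ r))))))) ⟩
    geo b ⊕ ∑[ v < a ] ∑[ r < b ] (q ^ (b + toℕ v * b + toℕ r))            ∎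

  geo-reversed : ∀ n → ∑[ v < suc n ] (q ^ (n ∸ toℕ v)) ≈ geo (suc n)
  geo-reversed n = trans (sum-cong-≋ {suc n} λ v → reflexive (≡.cong (q ^_) (≡.sym (opposite-prop v))))
                         (sum-opposite (suc n) (λ v → q ^ toℕ v))

  exponent-shift : ∀ r v m′ n → v ℕ.≤ n → suc r + ((n ∸ v) + v * suc m′) ≡ suc n + (v * m′ + r)
  exponent-shift r v m′ n v≤n = ≡.trans (solve 4 (λ r v m′ d → (con 1 :+ r) :+ (d :+ v :* (con 1 :+ m′))
                                                          := (con 1 :+ (d :+ v)) :+ (v :* m′ :+ r)) ≡.refl r v m′ (n ∸ v))
                                        (≡.cong (λ t → suc t + (v * m′ + r)) (ℕ.m∸n+n≡m v≤n))
    where open +-*-Solver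

  -- For r = 0 the exponents are n ∸ v ∈ {0,…,n}; for r = 1 + r′ they are (n + 1) + (v m′ + r′), which run
  -- through the next (n + 1) m′ values. So every exponent below (n + 1) m occurs exactly once.
  geo-weighted : ∀ m .{{_ : NonZero m}} n →
                 ∑[ r < m ] ∑[ v < suc n ] (q ^ (toℕ r + ((n ∸ toℕ v) + toℕ v * weight r))) ≈ geo (suc n * m)
  geo-weighted (suc m′) n = begin
    ∑[ v < suc n ] (q ^ ((n ∸ toℕ v) + toℕ v * 0)) ⊕ ∑[ r < m′ ] ∑[ v < suc n ] (q ^ (suc (toℕ r) + ((n ∸ toℕ v) + toℕ v * suc m′)))
      ≈⟨ +-cong (sum-cong-≋ {suc n} λ v → reflexive (≡.cong (q ^_) (≡.trans (≡.cong ((n ∸ toℕ v) +_) (ℕ.*-zeroʳ (toℕ v))) (ℕ.+-identityʳ _))))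
                (sum-cong-≋ {m′} λ r → sum-cong-≋ {suc n} λ v →
                   trans (reflexive (≡.cong (q ^_) (exponent-shift (toℕ r) (toℕ v) m′ n (ℕ.s≤s⁻¹ (toℕ<n v))))) (^-homo-* q (suc n) _)) ⟩
    ∑[ v < suc n ] (q ^ (n ∸ toℕ v)) ⊕ ∑[ r < m′ ] ∑[ v < suc n ] (q ^ suc n ⊗ q ^ (toℕ v * m′ + toℕ r))
      ≈⟨ +-cong (geo-reversed n) (trans (sum-cong-≋ {m′} λ r → sym (*-distribˡ-sum {suc n} (q ^ suc n) (λ v → q ^ (toℕ v * m′ + toℕ r))))
                                          (sym (*-distribˡ-sum {m′} (q ^ suc n) (λ r → ∑[ v < suc n ] (q ^ (toℕ v * m′ + toℕ r)))))) ⟩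
    geo (suc n) ⊕ q ^ suc n ⊗ ∑[ r < m′ ] ∑[ v < suc n ] (q ^ (toℕ v * m′ + toℕ r))
      ≈⟨ +-congˡ (*-congˡ (trans (∑-comm {m′} {suc n} (λ r v → q ^ (toℕ v * m′ + toℕ r))) (sym (geo-* (suc n) m′)))) ⟩
    geo (suc n) ⊕ q ^ suc n ⊗ geo (suc n * m′)                            ≈⟨ sym (geo-+ (suc n) (suc n * m′)) ⟩
    geo (suc n + suc n * m′)                                             ≡⟨ ≡.cong geo (≡.sym (ℕ.*-suc (suc n) m′)) ⟩
    geo (suc n * suc m′)                                                 ∎

lookup-∷ʳ-inject₁ : ∀ {a} {A : Set a} {k} (u : Vec A k) x (p : Fin k) → lookup (u ∷ʳ x) (inject₁ p) ≡ lookup u p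
lookup-∷ʳ-inject₁ (y ∷ u) x zero = ≡.refl
lookup-∷ʳ-inject₁ (y ∷ u) x (suc p) = lookup-∷ʳ-inject₁ u x p

lookup-∷ʳ-last : ∀ {a} {A : Set a} {k} (u : Vec A k) x → lookup (u ∷ʳ x) (fromℕ k) ≡ x
lookup-∷ʳ-last [] x = ≡.refl
lookup-∷ʳ-last (y ∷ u) x = lookup-∷ʳ-last u x

allPairs-∷ʳ⁻ : ∀ {a r} {A : Set a} {_~_ : A → A → Set r} (xs : List A) {x} →
               AllPairs _~_ (xs ++ x ∷ []) → All (_~ x) xs × AllPairs _~_ xs
allPairs-∷ʳ⁻ [] _ = [] , []
allPairs-∷ʳ⁻ (y ∷ xs) (y~ ∷ pairs) =
  let (y~xs , y~x) = All.∷ʳ⁻ y~ ; (xs~x , xs-pairs) = allPairs-∷ʳ⁻ xs pairs in (y~x ∷ xs~x) , (y~xs ∷ xs-pairs)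

punchIn-mono-< : ∀ {n} (v : Fin (suc n)) {a b : Fin n} → a < b → punchIn v a < punchIn v b
punchIn-mono-< v {a} {b} a<b = ℕ.≤∧≢⇒< (punchIn-mono-≤ v a b (ℕ.<⇒≤ a<b))
  (λ eq → ℕ.<⇒≢ a<b (≡.cong toℕ (punchIn-injective v a b (toℕ-injective eq))))

punchIn-above : ∀ {n} (v : Fin (suc n)) (b : Fin n) → toℕ v ℕ.≤ toℕ b → v < punchIn v b
punchIn-above zero b _ = ℕ.s≤s ℕ.z≤n
punchIn-above (suc v) (suc b) (ℕ.s≤s v≤b) = ℕ.s≤s (punchIn-above v b v≤b)

punchIn-below : ∀ {n} (v : Fin (suc n)) (b : Fin n) → toℕ b ℕ.< toℕ v → punchIn v b < v
punchIn-below (suc v) zero _ = ℕ.s≤s ℕ.z≤n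
punchIn-below (suc v) (suc b) (ℕ.s≤s b<v) = ℕ.s≤s (punchIn-below v b b<v)

module NegativeRoots {m : ℕ} where
  open import Data.Fin.Properties using (<-cmp)
  open import Data.Sum using (inj₁; inj₂)
  open import Relation.Binary using (tri<; tri≈; tri>)
  open import Relation.Nullary.Decidable using (decidable-stable)

  module _ {n : ℕ} {i k : Fin m} where

    negative-vertical : {b : Fin n} → IsNegative ((i , b) , (k , b)) ⇔ toℕ k ℕ.< toℕ i
    negative-vertical {b} = mk⇔ to from
      where
      to : IsNegative ((i , b) , (k , b)) → toℕ k ℕ.< toℕ i
      to (distinct , ¬positive) with ℕ.<-cmp (toℕ k) (toℕ i)
      ... | tri< k<i _ _ = k<i
      ... | tri≈ _ k≡i _ = contradiction (≡.cong (_, b) (toℕ-injective (≡.sym k≡i))) distinct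
      ... | tri> _ _ i<k = contradiction (inj₁ (≡.refl , i<k)) ¬positive
      from : toℕ k ℕ.< toℕ i → IsNegative ((i , b) , (k , b))
      from k<i = (λ eq → ℕ.<-irrefl (≡.cong (λ x → toℕ (proj₁ x)) (≡.sym eq)) k<i) , λ where
        (inj₁ (_ , i<k)) → ℕ.<-asym k<i i<k
        (inj₂ (inj₁ (b<b , _))) → ℕ.<-irrefl ≡.refl b<b
        (inj₂ (inj₂ (b<b , _))) → ℕ.<-irrefl ≡.refl b<b

    module _ {j l : Fin n} where

      negative-rising : j < l → IsNegative ((i , j) , (k , l)) ⇔ toℕ k ≡ 0
      negative-rising j<l = mk⇔
        (λ (_ , ¬positive) → decidable-stable (toℕ k ℕ.≟ 0) (λ k≢0 → ¬positive (inj₂ (inj₂ (j<l , k≢0)))))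
        (λ k≡0 → (λ eq → ℕ.<-irrefl (≡.cong (λ x → toℕ (proj₂ x)) eq) j<l) , λ where
          (inj₁ (j≡l , _)) → ℕ.<-irrefl (≡.cong toℕ j≡l) j<l
          (inj₂ (inj₁ (l<j , _))) → ℕ.<-asym j<l l<j
          (inj₂ (inj₂ (_ , k≢0))) → k≢0 k≡0)

      negative-falling : l < j → IsNegative ((i , j) , (k , l)) ⇔ toℕ i ≢ 0
      negative-falling l<j = mk⇔
        (λ (_ , ¬positive) i≡0 → ¬positive (inj₂ (inj₁ (l<j , i≡0))))
        (λ i≢0 → (λ eq → ℕ.<-irrefl (≡.cong (λ x → toℕ (proj₂ x)) (≡.sym eq)) l<j) , λ where
          (inj₁ (j≡l , _)) → ℕ.<-irrefl (≡.cong toℕ (≡.sym j≡l)) l<j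
          (inj₂ (inj₁ (_ , i≡0))) → i≢0 i≡0
          (inj₂ (inj₂ (j<l , _))) → ℕ.<-asym l<j j<l)

  module _ {n n′ : ℕ} {φ : Fin n → Fin n′} (φ-mono : ∀ {a b} → a < b → φ a < φ b) where

    mono⇒reflects-< : ∀ {a b} → φ a < φ b → a < b
    mono⇒reflects-< {a} {b} φa<φb with <-cmp a b
    ... | tri< a<b _ _ = a<b
    ... | tri≈ _ ≡.refl _ = contradiction φa<φb (ℕ.<-irrefl ≡.refl)
    ... | tri> _ _ b<a = contradiction φa<φb (ℕ.<-asym (φ-mono b<a))

    mono⇒injective : ∀ {a b} → φ a ≡ φ b → a ≡ b
    mono⇒injective {a} {b} φa≡φb with <-cmp a b
    ... | tri< a<b _ _ = contradiction (≡.cong toℕ φa≡φb) (ℕ.<⇒≢ (φ-mono a<b))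
    ... | tri≈ _ a≡b _ = a≡b
    ... | tri> _ _ b<a = contradiction (≡.cong toℕ (≡.sym φa≡φb)) (ℕ.<⇒≢ (φ-mono b<a))

    negative-relabel : ∀ {i k : Fin m} {j l : Fin n} → IsNegative ((i , φ j) , (k , φ l)) ⇔ IsNegative ((i , j) , (k , l))
    negative-relabel = mk⇔
      (λ (distinct , ¬positive) → (λ eq → distinct (≡.cong (λ x → proj₁ x , φ (proj₂ x)) eq)) , λ where
        (inj₁ (j≡l , i<k)) → ¬positive (inj₁ (≡.cong φ j≡l , i<k))
        (inj₂ (inj₁ (l<j , i≡0))) → ¬positive (inj₂ (inj₁ (φ-mono l<j , i≡0)))
        (inj₂ (inj₂ (j<l , k≢0))) → ¬positive (inj₂ (inj₂ (φ-mono j<l , k≢0))))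
      (λ (distinct , ¬positive) → (λ eq → distinct (≡.cong₂ _,_ (≡.cong proj₁ eq) (mono⇒injective (≡.cong proj₂ eq)))) , λ where
        (inj₁ (φj≡φl , i<k)) → ¬positive (inj₁ (mono⇒injective φj≡φl , i<k))
        (inj₂ (inj₁ (φl<φj , i≡0))) → ¬positive (inj₂ (inj₁ (mono⇒reflects-< φl<φj , i≡0)))
        (inj₂ (inj₂ (φj<φl , k≢0))) → ¬positive (inj₂ (inj₂ (mono⇒reflects-< φj<φl , k≢0))))

module Inversions (m : ℕ) .{{_ : NonZero m}} where
  open import Data.Nat using (_+_; _<?_; _≟_)
  open import Data.Nat.DivMod using (_mod_; _%_; m<n⇒m%n≡m)
  open import Data.Fin.Properties using (toℕ-fromℕ<; toℕ-fromℕ; toℕ-inject₁; inject₁ℕ<) renaming (_<?_ to _<ᶠ?_)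
  open import Data.Vec.Properties using (lookup-map)
  import Data.Vec
  open Counting
  open NegativeRoots

  toℕ-mod : ∀ a → toℕ (a mod m) ≡ a % m
  toℕ-mod a = toℕ-fromℕ< _

  -- `actPoint w (k , j)` is `rotate k (lookup w j)` definitionally.
  rotate : ∀ {n} → Fin m → Point m n → Point m n
  rotate k (r , b) = ((toℕ k + toℕ r) mod m , b)

  rotate-0 : ∀ {n} (x : Point m n) → rotate (0 mod m) x ≡ x
  rotate-0 (r , b) = ≡.cong (_, b) (toℕ-injective (≡.trans (toℕ-mod (toℕ (0 mod m) + toℕ r))
    (≡.trans (≡.cong (λ z → (z + toℕ r) % m) (≡.trans (toℕ-mod 0) (m<n⇒m%n≡m (ℕ.>-nonZero⁻¹ m)))) (m<n⇒m%n≡m (toℕ<n r)))))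

  -- For x = w(e_p) and y = w(e_j), invSelf x and invPair y x count the roots e_p − ε^k e_p (k ≠ 0),
  -- resp. e_p − ε^k e_j, of Δ whose image under w is negative.
  invSelf : ∀ {n} → Point m n → ℕ
  invSelf x = ∑[ k < m ] when (¬? (toℕ k ≟ 0)) (when (isNegative? (rotate (0 mod m) x , rotate k x)) 1)

  invPair : ∀ {n} → Point m n → Point m n → ℕ
  invPair y x = ∑[ k < m ] when (isNegative? (rotate (0 mod m) x , rotate k y)) 1

  invAt : ∀ {n k} → Vec (Point m n) k → Fin k → ℕ
  invAt {k = k} w p = invSelf (lookup w p) + ∑[ j < k ] when (j <ᶠ? p) (invPair (lookup w j) (lookup w p))

  invSum : ∀ {n k} → Vec (Point m n) k → ℕ
  invSum {k = k} w = ∑[ p < k ] invAt w p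

  invᵢ≡invAt : ∀ {n} (w : Vec (Point m n) n) (i : Fin n) → invᵢ w i ≡ invAt w (opposite i)
  invᵢ≡invAt {n} w i = begin
    invᵢ w i                                                     ≡⟨ length-filter≡count (λ d → isNegative? (actRoot w d)) (Δ i) ⟩
    sumOver (map diag nonzero ++ concatMap (λ k → map (pair k) below) (allFin m)) negative
                                                                 ≡⟨ sumOver-++ (map diag nonzero) _ negative ⟩
    sumOver (map diag nonzero) negative + sumOver (concatMap (λ k → map (pair k) below) (allFin m)) negative
                                                                 ≡⟨ ≡.cong₂ _+_ self-part pair-part ⟩
    invAt w p                                                    ∎
    where
    open ≡.≡-Reasoning
    p = opposite i
    negative : Root m n → ℕ
    negative d = when (isNegative? (actRoot w d)) 1
    diag : Fin m → Root m n
    diag k = ((0 mod m , p) , (k , p))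
    pair : Fin m → Fin n → Root m n
    pair k j = ((0 mod m , p) , (k , j))
    nonzero = filter (λ k → ¬? (toℕ k ≟ 0)) (allFin m)
    below = filter (λ j → j <ᶠ? p) (allFin n)
    self-part : sumOver (map diag nonzero) negative ≡ invSelf (lookup w p)
    self-part = ≡.trans (sumOver-map diag nonzero negative)
                (≡.trans (sumOver-filter (λ k → ¬? (toℕ k ≟ 0)) (allFin m) _) (sumOver-allFin m _))
    pair-part : sumOver (concatMap (λ k → map (pair k) below) (allFin m)) negative
              ≡ ∑[ j < n ] when (j <ᶠ? p) (invPair (lookup w j) (lookup w p))
    pair-part = begin
      sumOver (concatMap (λ k → map (pair k) below) (allFin m)) negative
        ≡⟨ sumOver-concatMap (λ k → map (pair k) below) (allFin m) negative ⟩
      sumOver (allFin m) (λ k → sumOver (map (pair k) below) negative)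
        ≡⟨ sumOver-cong (allFin m) (λ k → ≡.trans (sumOver-map (pair k) below negative) (sumOver-filter (λ j → j <ᶠ? p) (allFin n) _)) ⟩
      sumOver (allFin m) (λ k → sumOver (allFin n) (λ j → when (j <ᶠ? p) (negative (pair k j))))
        ≡⟨ sumOver-comm (allFin m) (allFin n) _ ⟩
      sumOver (allFin n) (λ j → sumOver (allFin m) (λ k → when (j <ᶠ? p) (negative (pair k j))))
        ≡⟨ sumOver-cong (allFin n) (λ j → ≡.sym (when-sumOver (j <ᶠ? p) (allFin m) _)) ⟩
      sumOver (allFin n) (λ j → when (j <ᶠ? p) (sumOver (allFin m) (λ k → negative (pair k j))))
        ≡⟨ ≡.trans (sumOver-allFin n _) (sum-cong-≋ {n} (λ j → ≡.cong (when (j <ᶠ? p)) (sumOver-allFin m _))) ⟩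
      ∑[ j < n ] when (j <ᶠ? p) (invPair (lookup w j) (lookup w p)) ∎

  inv≡invSum : ∀ {n} (w : Vec (Point m n) n) → inv w ≡ invSum w
  inv≡invSum {n} w = ≡.trans (sumOver-allFin n (invᵢ w)) (≡.trans (sum-cong-≋ {n} (invᵢ≡invAt w)) (sum-opposite n (invAt w)))

  module _ {n : ℕ} where

    invSelf-closed : (r : Fin m) (b : Fin n) → invSelf (r , b) ≡ toℕ r
    invSelf-closed r b = begin
      invSelf (r , b)
        ≡⟨ sum-cong-≋ {m} (λ k → ≡.cong (λ x → when (¬? (toℕ k ≟ 0)) (when (isNegative? (x , rotate k (r , b))) 1)) (rotate-0 (r , b))) ⟩
      ∑[ k < m ] when (¬? (toℕ k ≟ 0)) (when (isNegative? ((r , b) , rotate k (r , b))) 1)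
        ≡⟨ sum-cong-≋ {m} (λ k → when-when (¬? (toℕ k ≟ 0)) (isNegative? ((r , b) , rotate k (r , b))) (rotated k <? toℕ r)
                                       (λ _ neg → fall k neg) (λ lt → nonzero k lt , Equivalence.from negative-vertical (lower k lt)) 1) ⟩
      ∑[ k < m ] when (rotated k <? toℕ r) 1    ≡⟨ sum-rotate m (toℕ r) (toℕ<n r) (λ t → when (t <? toℕ r) 1) ⟩
      ∑[ k < m ] when (toℕ k <? toℕ r) 1        ≡⟨ count-< (ℕ.<⇒≤ (toℕ<n r)) ⟩
      toℕ r                                     ∎
      where
      open ≡.≡-Reasoning
      rotated : Fin m → ℕ
      rotated k = (toℕ k + toℕ r) % m
      lower : ∀ k → rotated k ℕ.< toℕ r → toℕ (proj₁ (rotate k (r , b))) ℕ.< toℕ r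
      lower k = ≡.subst (ℕ._< toℕ r) (≡.sym (toℕ-mod _))
      fall : ∀ k → IsNegative ((r , b) , rotate k (r , b)) → rotated k ℕ.< toℕ r
      fall k neg = ≡.subst (ℕ._< toℕ r) (toℕ-mod _) (Equivalence.to negative-vertical neg)
      nonzero : ∀ k → rotated k ℕ.< toℕ r → toℕ k ≢ 0
      nonzero k lt k≡0 = ℕ.<-irrefl (≡.trans (≡.cong (λ z → (z + toℕ r) % m) k≡0) (m<n⇒m%n≡m (toℕ<n r))) lt

    invPair-rising : (s r : Fin m) {b b′ : Fin n} → b < b′ → invPair (s , b′) (r , b) ≡ 1
    invPair-rising s r {b} {b′} b<b′ = begin
      invPair (s , b′) (r , b)
        ≡⟨ sum-cong-≋ {m} (λ k → ≡.cong (λ x → when (isNegative? (x , rotate k (s , b′))) 1) (rotate-0 (r , b))) ⟩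
      ∑[ k < m ] when (isNegative? ((r , b) , rotate k (s , b′))) 1
        ≡⟨ sum-cong-≋ {m} (λ k → when-⇔ (isNegative? ((r , b) , rotate k (s , b′))) ((toℕ k + toℕ s) % m ≟ 0)
                                     (mk⇔ (λ neg → ≡.trans (≡.sym (toℕ-mod _)) (Equivalence.to (negative-rising b<b′) neg))
                                          (λ ≡0 → Equivalence.from (negative-rising b<b′) (≡.trans (toℕ-mod _) ≡0))) 1) ⟩
      ∑[ k < m ] when ((toℕ k + toℕ s) % m ≟ 0) 1 ≡⟨ sum-rotate m (toℕ s) (toℕ<n s) (λ t → when (t ≟ 0) 1) ⟩
      ∑[ k < m ] when (toℕ k ≟ 0) 1               ≡⟨ count-≡0 m ⟩
      1                                           ∎
      where open ≡.≡-Reasoning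

    invPair-falling : (s r : Fin m) {b b′ : Fin n} → b′ < b → invPair (s , b′) (r , b) ≡ weight r
    invPair-falling s r {b} {b′} b′<b = begin
      invPair (s , b′) (r , b)
        ≡⟨ sum-cong-≋ {m} (λ k → ≡.cong (λ x → when (isNegative? (x , rotate k (s , b′))) 1) (rotate-0 (r , b))) ⟩
      ∑[ k < m ] when (isNegative? ((r , b) , rotate k (s , b′))) 1
        ≡⟨ sum-cong-≋ {m} (λ k → when-⇔ (isNegative? ((r , b) , rotate k (s , b′))) (¬? (toℕ r ≟ 0)) (negative-falling b′<b) 1) ⟩
      ∑[ k < m ] when (¬? (toℕ r ≟ 0)) 1          ≡⟨ count-const (¬? (toℕ r ≟ 0)) m ⟩
      weight r                                    ∎
      where open ≡.≡-Reasoning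

  module _ {n n′ : ℕ} {φ : Fin n → Fin n′} (φ-mono : ∀ {a b} → a < b → φ a < φ b) where

    relabel : Point m n → Point m n′
    relabel (r , b) = (r , φ b)

    invPair-relabel : (y x : Point m n) → invPair (relabel y) (relabel x) ≡ invPair y x
    invPair-relabel y x = sum-cong-≋ {m} (λ k →
      when-⇔ (isNegative? (rotate (0 mod m) (relabel x) , rotate k (relabel y)))
             (isNegative? (rotate (0 mod m) x , rotate k y)) (negative-relabel φ-mono) 1)

    invSum-relabel : ∀ {k} (u : Vec (Point m n) k) → invSum (Data.Vec.map relabel u) ≡ invSum u
    invSum-relabel {k} u = sum-cong-≋ {k} λ p → ≡.cong₂ _+_
      (≡.trans (≡.cong invSelf (lookup-map p relabel u))
               (≡.trans (invSelf-closed _ _) (≡.sym (invSelf-closed _ _))))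
      (sum-cong-≋ {k} λ j → ≡.cong (when (j <ᶠ? p))
        (≡.trans (≡.cong₂ invPair (lookup-map j relabel u) (lookup-map p relabel u)) (invPair-relabel (lookup u j) (lookup u p))))

  invSum-∷ʳ : ∀ {n k} (u : Vec (Point m n) k) (x : Point m n) →
              invSum (u ∷ʳ x) ≡ invSum u + (invSelf x + ∑[ j < k ] invPair (lookup u j) x)
  invSum-∷ʳ {n} {k} u x = ≡.trans (sum-init-last (invAt (u ∷ʳ x))) (≡.cong₂ _+_ (sum-cong-≋ {k} earlier) last)
    where
    w = u ∷ʳ x
    inject₁<fromℕ : (j : Fin k) → inject₁ j < fromℕ k
    inject₁<fromℕ j = ≡.subst (toℕ (inject₁ j) ℕ.<_) (≡.sym (toℕ-fromℕ k)) (inject₁ℕ< j)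
    earlier : ∀ p → invAt w (inject₁ p) ≡ invAt u p
    earlier p = ≡.cong₂ _+_ (≡.cong invSelf (lookup-∷ʳ-inject₁ u x p))
      (≡.trans (sum-init-last {k} (λ j → when (j <ᶠ? inject₁ p) (invPair (lookup w j) (lookup w (inject₁ p)))))
      (≡.trans (≡.cong₂ _+_
        (sum-cong-≋ {k} λ j → ≡.trans
          (when-⇔ (inject₁ j <ᶠ? inject₁ p) (j <ᶠ? p) (mk⇔ (≡.subst₂ ℕ._<_ (toℕ-inject₁ j) (toℕ-inject₁ p))
                                                             (≡.subst₂ ℕ._<_ (≡.sym (toℕ-inject₁ j)) (≡.sym (toℕ-inject₁ p)))) _)
          (≡.cong (when (j <ᶠ? p)) (≡.cong₂ invPair (lookup-∷ʳ-inject₁ u x j) (lookup-∷ʳ-inject₁ u x p))))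
        (when-no (fromℕ k <ᶠ? inject₁ p) (ℕ.<-asym (inject₁<fromℕ p)) _))
      (ℕ.+-identityʳ _)))
    last : invAt w (fromℕ k) ≡ invSelf x + ∑[ j < k ] invPair (lookup u j) x
    last = ≡.cong₂ _+_ (≡.cong invSelf (lookup-∷ʳ-last u x))
      (≡.trans (sum-init-last {k} (λ j → when (j <ᶠ? fromℕ k) (invPair (lookup w j) (lookup w (fromℕ k)))))
      (≡.trans (≡.cong₂ _+_
        (sum-cong-≋ {k} λ j → ≡.trans (when-yes (inject₁ j <ᶠ? fromℕ k) (inject₁<fromℕ j) _)
                                        (≡.cong₂ invPair (lookup-∷ʳ-inject₁ u x j) (lookup-∷ʳ-last u x)))
        (when-no (fromℕ k <ᶠ? fromℕ k) (ℕ.<-irrefl ≡.refl) _))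
      (ℕ.+-identityʳ _)))

module Appending (m : ℕ) .{{_ : NonZero m}} where
  open import Data.Nat using (_+_; _*_; _∸_; _≤?_; _<?_)
  open import Data.Fin.Properties using (punchIn-injective) renaming (_≟_ to _≟ᶠ_)
  import Data.List.Relation.Unary.All as All
  open import Data.List.Relation.Unary.AllPairs as AllPairs using (allPairs?)
  import Data.List.Relation.Unary.AllPairs.Properties as AllPairs
  import Data.Vec
  open import Data.Vec using (toList)
  open import Data.Vec.Properties using (lookup-map; toList-∷ʳ; map-∷ʳ; toList-map; length-toList)
  open Counting
  open Inversions m

  points : ∀ n → List (Point m n)
  points n = cartesianProduct (allFin m) (allFin n)

  columns : ∀ {n k} → Vec (Point m n) k → List (Fin n)
  columns w = toList (Data.Vec.map proj₂ w)

  distinct? : ∀ {n k} (w : Vec (Point m n) k) → Dec (AllPairs _≢_ (columns w))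
  distinct? w = allPairs? (λ a b → ¬? (a ≟ᶠ b)) (columns w)

  avoids? : ∀ {n k} (v : Fin n) (u : Vec (Point m n) k) → Dec (All (_≢ v) (columns u))
  avoids? v u = All.all? (λ b → ¬? (b ≟ᶠ v)) (columns u)

  punchPoint : ∀ {n} → Fin (suc n) → Point m n → Point m (suc n)
  punchPoint v = relabel (punchIn-mono-< v)

  columns-∷ʳ : ∀ {n k} (u : Vec (Point m n) k) x → columns (u ∷ʳ x) ≡ columns u ++ proj₂ x ∷ []
  columns-∷ʳ u x = ≡.trans (≡.cong toList (map-∷ʳ proj₂ x u)) (toList-∷ʳ (proj₂ x) (Data.Vec.map proj₂ u))

  columns-punch : ∀ {n k} (v : Fin (suc n)) (u : Vec (Point m n) k) → columns (Data.Vec.map (punchPoint v) u) ≡ map (punchIn v) (columns u)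
  columns-punch v u = ≡.trans (≡.cong toList (≡.trans (≡.sym (Data.Vec.Properties.map-∘ proj₂ (punchPoint v) u))
                                                        (Data.Vec.Properties.map-∘ (punchIn v) proj₂ u)))
                              (toList-map (punchIn v) (Data.Vec.map proj₂ u))

  distinct-∷ʳ : ∀ {n k} (u : Vec (Point m n) k) x →
                AllPairs _≢_ (columns (u ∷ʳ x)) ⇔ (All (_≢ proj₂ x) (columns u) × AllPairs _≢_ (columns u))
  distinct-∷ʳ u x = mk⇔
    (λ distinct → allPairs-∷ʳ⁻ (columns u) (≡.subst (AllPairs _≢_) (columns-∷ʳ u x) distinct))
    (λ (avoid , distinct) → ≡.subst (AllPairs _≢_) (≡.sym (columns-∷ʳ u x))
                              (AllPairs.++⁺ distinct ([] ∷ []) (All.map (_∷ []) avoid)))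

  distinct-punch : ∀ {n k} (v : Fin (suc n)) (u : Vec (Point m n) k) →
                   AllPairs _≢_ (columns (Data.Vec.map (punchPoint v) u)) ⇔ AllPairs _≢_ (columns u)
  distinct-punch v u = mk⇔
    (λ distinct → AllPairs.map (λ ne eq → ne (≡.cong (punchIn v) eq))
                    (AllPairs.map⁻ (≡.subst (AllPairs _≢_) (columns-punch v u) distinct)))
    (λ distinct → ≡.subst (AllPairs _≢_) (≡.sym (columns-punch v u))
                    (AllPairs.map⁺ (AllPairs.map (λ ne eq → ne (punchIn-injective v _ _ eq)) distinct)))

  invPair-punchIn : ∀ {n} (s r : Fin m) (v : Fin (suc n)) (b : Fin n) →
    invPair (s , punchIn v b) (r , v) ≡ when (toℕ v ≤? toℕ b) 1 + when (toℕ b <? toℕ v) 1 * weight r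
  invPair-punchIn s r v b with toℕ v ≤? toℕ b | toℕ b <? toℕ v
  ... | yes v≤b | yes b<v = contradiction v≤b (ℕ.<⇒≱ b<v)
  ... | yes v≤b | no _ = invPair-rising s r (punchIn-above v b v≤b)
  ... | no _ | yes b<v = ≡.trans (invPair-falling s r (punchIn-below v b b<v)) (≡.sym (ℕ.+-identityʳ _))
  ... | no v≰b | no b≮v = contradiction (ℕ.≮⇒≥ b≮v) v≰b

  sum-columns : ∀ {n k} (u : Vec (Point m n) k) (f : Fin n → ℕ) → ∑[ j < k ] f (proj₂ (lookup u j)) ≡ sumOver (columns u) f
  sum-columns [] f = ≡.refl
  sum-columns (y ∷ u) f = ≡.cong (f (proj₂ y) +_) (sum-columns u f)

  -- Appending x = (r , v) creates r inversions of its own, one for each of the n ∸ v earlier entries in a column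
  -- above v, and weight r for each of the v earlier entries in a column below v.
  invLast : ∀ n → Point m (suc n) → ℕ
  invLast n (r , v) = toℕ r + ((n ∸ toℕ v) + toℕ v * weight r)

  invLast-correct : ∀ n (x : Point m (suc n)) (u′ : Vec (Point m n) n) → AllPairs _≢_ (columns u′) →
    invSelf x + ∑[ j < n ] invPair (lookup (Data.Vec.map (punchPoint (proj₂ x)) u′) j) x ≡ invLast n x
  invLast-correct n (r , v) u′ distinct = ≡.cong₂ _+_ (invSelf-closed r v) (begin-≡
    ∑[ j < n ] invPair (lookup (Data.Vec.map (punchPoint v) u′) j) (r , v)
      ≡⟨ sum-cong-≋ {n} (λ j → ≡.trans (≡.cong (λ y → invPair y (r , v)) (lookup-map j (punchPoint v) u′))
                                           (invPair-punchIn _ r v (proj₂ (lookup u′ j)))) ⟩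
    ∑[ j < n ] (above (column j) + below (column j) * weight r)
      ≡⟨ ∑-distrib-+ (λ j → above (column j)) _ ⟩
    ∑[ j < n ] above (column j) + ∑[ j < n ] (below (column j) * weight r)
      ≡⟨ ≡.cong (∑[ j < n ] above (column j) +_) (≡.sym (*-distribʳ-sum (weight r) (λ j → below (column j)))) ⟩
    ∑[ j < n ] above (column j) + ∑[ j < n ] below (column j) * weight r
      ≡⟨ ≡.cong₂ (λ a b → a + b * weight r) (count above? (count-≥ n (toℕ v))) (count below? (count-< (ℕ.s≤s⁻¹ (toℕ<n v)))) ⟩
    (n ∸ toℕ v) + toℕ v * weight r ∎)
    where
    open ≡.≡-Reasoning renaming (begin_ to begin-≡_)
    column : Fin n → Fin n
    column j = proj₂ (lookup u′ j)
    above? below? : (b : Fin n) → Dec _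
    above? b = toℕ v ≤? toℕ b
    below? b = toℕ b <? toℕ v
    above below : Fin n → ℕ
    above b = when (above? b) 1
    below b = when (below? b) 1
    count : ∀ {p} {P : Fin n → Set p} (P? : ∀ b → Dec (P b)) {c} → ∑[ b < n ] when (P? b) 1 ≡ c →
            ∑[ j < n ] when (P? (column j)) 1 ≡ c
    count P? total = ≡.trans (sum-columns u′ _) (≡.trans (count-unique-full P? distinct (length-toList (Data.Vec.map proj₂ u′))) total)

module Enumeration {c ℓ} (R : CommutativeSemiring c ℓ) (q : CommutativeSemiring.Carrier R) where
  open import Data.Nat using (_*_)
  open import Data.Fin.Properties using (toℕ-fromℕ; toℕ-inject₁) renaming (_≟_ to _≟ᶠ_)
  import Data.Vec
  open CommutativeSemiring R hiding (zero) renaming (_+_ to _⊕_; _*_ to _⊗_)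
  open import Algebra.Definitions.RawSemiring rawSemiring using (_^_)
  open import Algebra.Properties.Semiring.Exp semiring using (^-homo-*)
  open import Algebra.Properties.Monoid.Sum *-monoid using ()
    renaming (sum to product; sum-cong-≋ to product-cong; sum-init-last to product-init-last)
  open import Relation.Binary.Reasoning.Setoid setoid
  open Sums R
  open GeometricSums R q
  module ℕ∑ = Counting

  module _ (m : ℕ) .{{_ : NonZero m}} where
    open Inversions m
    open Appending m

    sumOver-points-avoiding : ∀ n (v : Fin (suc n)) (h : Point m (suc n) → Carrier) →
      sumOver (points (suc n)) (λ x → when (¬? (proj₂ x ≟ᶠ v)) (h x)) ≈ sumOver (points n) (λ y → h (punchPoint v y))
    sumOver-points-avoiding n v h = begin
      sumOver (points (suc n)) (λ x → when (¬? (proj₂ x ≟ᶠ v)) (h x))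
        ≈⟨ sumOver-cartesianProduct (allFin m) (allFin (suc n)) _ ⟩
      sumOver (allFin m) (λ r → sumOver (allFin (suc n)) (λ b → when (¬? (b ≟ᶠ v)) (h (r , b))))
        ≈⟨ sumOver-cong (allFin m) (λ r → trans (reflexive (sumOver-allFin (suc n) _))
             (trans (sum-punchIn n v (λ b → h (r , b))) (reflexive (≡.sym (sumOver-allFin n _))))) ⟩
      sumOver (allFin m) (λ r → sumOver (allFin n) (λ b → h (r , punchIn v b)))
        ≈⟨ sym (sumOver-cartesianProduct (allFin m) (allFin n) _) ⟩
      sumOver (points n) (λ y → h (punchPoint v y)) ∎

    sumOver-allVecs-avoiding : ∀ n k (v : Fin (suc n)) (G : Vec (Point m (suc n)) k → Carrier) →
      sumOver (allVecs (points (suc n)) k) (λ u → when (avoids? v u) (G u))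
        ≈ sumOver (allVecs (points n) k) (λ u′ → G (Data.Vec.map (punchPoint v) u′))
    sumOver-allVecs-avoiding n zero v G = refl
    sumOver-allVecs-avoiding n (suc k) v G = begin
      sumOver (allVecs (points (suc n)) (suc k)) (λ u → when (avoids? v u) (G u))
        ≈⟨ sumOver-allVecs-∷ (points (suc n)) k _ ⟩
      sumOver (points (suc n)) (λ y → sumOver (allVecs (points (suc n)) k) (λ u → when (avoids? v (y ∷ u)) (G (y ∷ u))))
        ≈⟨ sumOver-cong (points (suc n)) (λ y → trans
             (sumOver-cong (allVecs (points (suc n)) k) (λ u →
               sym (when-when (¬? (proj₂ y ≟ᶠ v)) (avoids? v u) (avoids? v (y ∷ u)) _∷_ (λ { (y≢v ∷ avoid) → y≢v , avoid }) _)))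
             (sym (when-sumOver (¬? (proj₂ y ≟ᶠ v)) (allVecs (points (suc n)) k) _))) ⟩
      sumOver (points (suc n)) (λ y → when (¬? (proj₂ y ≟ᶠ v))
        (sumOver (allVecs (points (suc n)) k) (λ u → when (avoids? v u) (G (y ∷ u)))))
        ≈⟨ sumOver-cong (points (suc n)) (λ y → when-congʳ (¬? (proj₂ y ≟ᶠ v)) (λ _ → sumOver-allVecs-avoiding n k v (λ u → G (y ∷ u)))) ⟩
      sumOver (points (suc n)) (λ y → when (¬? (proj₂ y ≟ᶠ v))
        (sumOver (allVecs (points n) k) (λ u′ → G (y ∷ Data.Vec.map (punchPoint v) u′))))
        ≈⟨ sumOver-points-avoiding n v _ ⟩
      sumOver (points n) (λ y → sumOver (allVecs (points n) k) (λ u′ → G (punchPoint v y ∷ Data.Vec.map (punchPoint v) u′)))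
        ≈⟨ sym (sumOver-allVecs-∷ (points n) k _) ⟩
      sumOver (allVecs (points n) (suc k)) (λ u′ → G (Data.Vec.map (punchPoint v) u′)) ∎

    gen : ℕ → Carrier
    gen n = sumOver (allVecs (points n) n) (λ w → when (distinct? w) (q ^ invSum w))

    invGenFun≈gen : ∀ n → invGenFun R m n q ≈ gen n
    invGenFun≈gen n = trans (sumOver-filter distinct? (allVecs (points n) n) (λ w → q ^ inv w))
      (sumOver-cong (allVecs (points n) n) (λ w → reflexive (≡.cong (λ e → when (distinct? w) (q ^ e)) (inv≡invSum w))))

    sumOver-appending : ∀ n (x : Point m (suc n)) →
      sumOver (allVecs (points (suc n)) n) (λ u → when (distinct? (u ∷ʳ x)) (q ^ invSum (u ∷ʳ x))) ≈ q ^ invLast n x ⊗ gen n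
    sumOver-appending n x@(r , v) = begin
      sumOver (allVecs (points (suc n)) n) (λ u → when (distinct? (u ∷ʳ x)) (q ^ invSum (u ∷ʳ x)))
        ≈⟨ sumOver-cong (allVecs (points (suc n)) n) (λ u → trans
             (sym (when-when (avoids? v u) (distinct? u) (distinct? (u ∷ʳ x))
                             (λ avoid distinct → Equivalence.from (distinct-∷ʳ u x) (avoid , distinct)) (Equivalence.to (distinct-∷ʳ u x)) _))
             (reflexive (≡.cong (λ e → when (avoids? v u) (when (distinct? u) (q ^ e))) (invSum-∷ʳ u x)))) ⟩
      sumOver (allVecs (points (suc n)) n) (λ u → when (avoids? v u) (G u))
        ≈⟨ sumOver-allVecs-avoiding n n v G ⟩
      sumOver (allVecs (points n) n) (λ u′ → G (Data.Vec.map (punchPoint v) u′))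
        ≈⟨ sumOver-cong (allVecs (points n) n) (λ u′ → trans
             (when-⇔ (distinct? (Data.Vec.map (punchPoint v) u′)) (distinct? u′) (distinct-punch v u′) _)
             (when-congʳ (distinct? u′) (λ distinct → reflexive (≡.cong (q ^_)
               (≡.cong₂ ℕ._+_ (invSum-relabel (punchIn-mono-< v) u′) (invLast-correct n x u′ distinct)))))) ⟩
      sumOver (allVecs (points n) n) (λ u′ → when (distinct? u′) (q ^ (invSum u′ ℕ.+ invLast n x)))
        ≈⟨ sumOver-cong (allVecs (points n) n) (λ u′ → trans
             (when-congʳ (distinct? u′) (λ _ → trans (^-homo-* q (invSum u′) (invLast n x)) (*-comm _ _))) (when-*ˡ (distinct? u′) _ _)) ⟩
      sumOver (allVecs (points n) n) (λ u′ → q ^ invLast n x ⊗ when (distinct? u′) (q ^ invSum u′))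
        ≈⟨ sym (*-distribˡ-sumOver _ (allVecs (points n) n) _) ⟩
      q ^ invLast n x ⊗ gen n ∎
      where
      G : Vec (Point m (suc n)) n → Carrier
      G u = when (distinct? u) (q ^ (invSum u ℕ.+ (invSelf x ℕ.+ ℕ∑.∑[ j < n ] invPair (lookup u j) x)))

    sumOver-points-invLast : ∀ n → sumOver (points (suc n)) (λ x → q ^ invLast n x) ≈ geo (suc n * m)
    sumOver-points-invLast n = trans (sumOver-cartesianProduct (allFin m) (allFin (suc n)) _)
      (trans (reflexive (sumOver-allFin m _))
      (trans (sum-cong-≋ {m} (λ r → reflexive (sumOver-allFin (suc n) _))) (geo-weighted m n)))

    gen-suc : ∀ n → gen (suc n) ≈ geo (suc n * m) ⊗ gen n
    gen-suc n = begin
      gen (suc n)                                                     ≈⟨ sumOver-allVecs-∷ʳ P n F ⟩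
      sumOver (allVecs P n) (λ u → sumOver P (λ x → F (u ∷ʳ x)))      ≈⟨ sumOver-comm (allVecs P n) P (λ u x → F (u ∷ʳ x)) ⟩
      sumOver P (λ x → sumOver (allVecs P n) (λ u → F (u ∷ʳ x)))      ≈⟨ sumOver-cong P (λ x → trans (sumOver-appending n x) (*-comm _ _)) ⟩
      sumOver P (λ x → gen n ⊗ q ^ invLast n x)                       ≈⟨ sym (*-distribˡ-sumOver (gen n) P _) ⟩
      gen n ⊗ sumOver P (λ x → q ^ invLast n x)                       ≈⟨ *-comm _ _ ⟩
      sumOver P (λ x → q ^ invLast n x) ⊗ gen n                       ≈⟨ *-congʳ (sumOver-points-invLast n) ⟩
      geo (suc n * m) ⊗ gen n                                         ∎
      where
      P = points (suc n)
      F : Vec (Point m (suc n)) (suc n) → Carrier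
      F w = when (distinct? w) (q ^ invSum w)

    gen≈product : ∀ n → gen n ≈ product (λ (i : Fin n) → geo (suc (toℕ i) * m))
    gen≈product zero = +-identityʳ 1#
    gen≈product (suc n) = begin
      gen (suc n)                                               ≈⟨ trans (gen-suc n) (*-comm _ _) ⟩
      gen n ⊗ geo (suc n * m)
        ≈⟨ *-cong (trans (gen≈product n) (product-cong {n} λ i → reflexive (≡.cong (λ t → geo (suc t * m)) (≡.sym (toℕ-inject₁ i)))))
                  (reflexive (≡.cong (λ t → geo (suc t * m)) (≡.sym (toℕ-fromℕ n)))) ⟩
      product (λ (i : Fin n) → geo (suc (toℕ (inject₁ i)) * m)) ⊗ geo (suc (toℕ (fromℕ n)) * m)
                                                                ≈⟨ sym (product-init-last {n} (λ i → geo (suc (toℕ i) * m))) ⟩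
      product (λ (i : Fin (suc n)) → geo (suc (toℕ i) * m))     ∎

    qProd≈product : ∀ n → qProd R m n q ≈ product (λ (i : Fin n) → geo (suc (toℕ i) * m))
    qProd≈product n = trans (reflexive (foldr-map-applyUpTo _⊗_ 1# (λ i → qInt R (suc i * m) q) (λ i → i) n))
                            (product-cong {n} λ i → reflexive (qInt≡geo (suc (toℕ i) * m)))

    invGenFun≈qProd : ∀ n → invGenFun R m n q ≈ qProd R m n q
    invGenFun≈qProd n = trans (invGenFun≈gen n) (trans (gen≈product n) (sym (qProd≈product n)))

corollary4p11 : ∀ {c ℓ} (R : CommutativeSemiring c ℓ) (m n : ℕ) .{{_ : NonZero m}} →
    2 ≤ m → 1 ≤ n → (q : CommutativeSemiring.Carrier R) →
    CommutativeSemiring._≈_ R (invGenFun R m n q) (qProd R m n q)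
corollary4p11 R m n _ _ q = Enumeration.invGenFun≈qProd R q m n
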